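{- Let $G$ be a graph, $k$ a positive integer, and $(T,\beta)$ a nice tree decomposition of $G$ of width at most $2k$. For every node $t\in V(T)$ and every partial solution $(D,\tau,S)$ for $t$, we have $|V(D)| = O(k^2)$.
   Context: A tree decomposition of $G$ is a pair $(T,\beta)$ with $T$ a tree and $\beta\colon V(T)\to 2^{V(G)}$ such that every vertex lies in some bag, every edge has both endpoints in some bag, and for every vertex $v$ the nodes whose bags contain $v$ induce a connected subtree; its width is $\max_t|\beta(t)|-1$. It is nice if $T$ is rooted and binary and every node $t$ is either an introduce node (one child $t'$ with $\beta(t)=\beta(t')\cup\{v\}$, $v\notin\beta(t')$, or a leaf with $\beta(t)=\{v\}$), a forget node (one child $t'$ with $\beta(t')=\beta(t)\cup\{v\}$, $v\notin\beta(t)$), or a join node (two children with bags equal to $\beta(t)$). For a node $t$, $G_t$ is the subgraph of $G$ induced by all vertices introduced at $t$ or at a descendant of $t$. The height of a rooted tree is the number of vertices on a longest root-to-leaf path. For a rooted tree $D$ and $X\subseteq V(D)$, $\mathrm{Clos}_D(X)$ is the subgraph of $D$ induced by $X$ and all ancestors of vertices of $X$. A partial solution for a graph $H$ is a pair $(D',\tau')$ where $D'$ is a rooted tree of height at most $k$ and $\tau'\colon V(H)\to V(D')$ is injective such that: for every $uv\in E(H)$, $\tau'(u)$ and $\tau'(v)$ are in an ancestor–descendant relationship in $D'$; for every $uv\in E(D')$ with $u,v\in\tau'(V(H))$, $\tau'^{ -1}(u)\tau'^{ -1}(v)\in E(H)$; and every leaf of $D'$ lies in $\tau'(V(H))$.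 A partial solution for a node $t$ is a triple $(D,\tau,S)$ where $D$ is a rooted tree, $\tau\colon\beta(t)\to V(D)$ is injective and $S\subseteq V(D)$, such that there exists a partial solution $(D',\tau')$ for $G_t$ with $D=\mathrm{Clos}_{D'}(\tau'(\beta(t)))$, $\tau = \tau'|_{\beta(t)}$, $\tau'(V(G_t)\setminus\beta(t))\cap V(D)=S$ and $\tau'(V(G_t)\setminus\beta(t))\setminus V(D) = V(D')\setminus V(D)$. -}

module Defs where

open import Data.Nat using (ℕ; _≤_; _<_; _+_; _*_)
open import Data.Fin using (Fin)
open import Data.Fin.Subset using (Subset; _∈_; _∉_; ⁅_⁆; _∪_; ∣_∣)
open import Data.Product using (Σ; ∃; ∃₂; _×_; _,_)
open import Data.Sum using (_⊎_)
open import Relation.Nullary using (¬_)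
open import Relation.Binary.PropositionalEquality using (_≡_; _≢_)

record Graph : Set₁ where
  field
    n          : ℕ
    Adj        : Fin n → Fin n → Set
    Adj-sym    : ∀ {u v} → Adj u v → Adj v u
    Adj-irrefl : ∀ {v} → ¬ Adj v v

open Graph public

-- Finite rooted trees, given by parent pointers.  'depth' certifies
-- acyclicity (every non-root vertex has depth one more than its parent,
-- the root has depth 0), so this is exactly a tree with a root.
-- 'parent root' is meaningless and never used.

record RootedTree : Set where
  field
    size         : ℕ
    root         : Fin size
    parent       : Fin size → Fin size
    depth        : Fin size → ℕ
    depth-root   : depth root ≡ 0
    depth-parent : ∀ v → v ≢ root → depth v ≡ Data.Nat.suc (depth (parent v))

open RootedTree public

module _ (D : RootedTree) where

  Child : Fin (size D) → Fin (size D) → Set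
  Child c t = (c ≢ root D) × (parent D c ≡ t)

  TreeEdge : Fin (size D) → Fin (size D) → Set
  TreeEdge u v = Child u v ⊎ Child v u

  Leaf : Fin (size D) → Set
  Leaf v = ∀ c → ¬ Child c v

  OnlyChild : Fin (size D) → Fin (size D) → Set
  OnlyChild t t' = Child t' t × (∀ c → Child c t → c ≡ t')

  data Anc (a : Fin (size D)) : Fin (size D) → Set where
    here : Anc a a
    step : ∀ {b} → b ≢ root D → Anc a (parent D b) → Anc a b

  AncDesc : Fin (size D) → Fin (size D) → Set
  AncDesc a b = Anc a b ⊎ Anc b a

  -- height (number of vertices on a longest root-to-leaf path) ≤ k
  HeightAtMost : ℕ → Set
  HeightAtMost k = ∀ v → depth D v < k

  data PathIn (P : Fin (size D) → Set) : Fin (size D) → Fin (size D) → Set where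
    stay : ∀ {a} → P a → PathIn P a a
    move : ∀ {a c b} → P a → TreeEdge a c → PathIn P c b → PathIn P a b

  ConnectedIn : (Fin (size D) → Set) → Set
  ConnectedIn P = ∀ a b → P a → P b → PathIn P a b

Bags : Graph → RootedTree → Set
Bags G T = Fin (size T) → Subset (n G)

record IsTreeDecomposition (G : Graph) (T : RootedTree) (β : Bags G T) : Set where
  field
    vertex-covered : ∀ v → ∃ λ t → v ∈ β t
    edge-covered   : ∀ u v → Adj G u v → ∃ λ t → (u ∈ β t) × (v ∈ β t)
    bags-connected : ∀ v → ConnectedIn T (λ t → v ∈ β t)

WidthAtMost : (G : Graph) (T : RootedTree) → Bags G T → ℕ → Set
WidthAtMost G T β w = ∀ t → ∣ β t ∣ ≤ w + 1

module _ (G : Graph) (T : RootedTree) (β : Bags G T) where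

  IntroduceNode : Fin (size T) → Fin (n G) → Set
  IntroduceNode t v =
      (∃ λ t' → OnlyChild T t t' × (β t ≡ β t' ∪ ⁅ v ⁆) × (v ∉ β t'))
    ⊎ (Leaf T t × (β t ≡ ⁅ v ⁆))

  ForgetNode : Fin (size T) → Fin (n G) → Set
  ForgetNode t v = ∃ λ t' → OnlyChild T t t' × (β t' ≡ β t ∪ ⁅ v ⁆) × (v ∉ β t)

  JoinNode : Fin (size T) → Set
  JoinNode t = ∃₂ λ c₁ c₂ → (c₁ ≢ c₂) × Child T c₁ t × Child T c₂ t
                 × (∀ c → Child T c t → (c ≡ c₁) ⊎ (c ≡ c₂))
                 × (β c₁ ≡ β t) × (β c₂ ≡ β t)

  record IsNiceTreeDecomposition : Set where
    field
      isTD      : IsTreeDecomposition G T β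
      nodeTypes : ∀ t → (∃ λ v → IntroduceNode t v) ⊎ (∃ λ v → ForgetNode t v) ⊎ JoinNode t

  -- V(G_t): vertices introduced at t or at a descendant of t
  InGt : Fin (size T) → Fin (n G) → Set
  InGt t v = ∃ λ s → Anc T t s × IntroduceNode s v

-- Partial solution (D', τ') for the induced subgraph H of G on the
-- vertex set P.  τ' is given as a function on all of V(G); only its
-- values on P matter.

record PartialSolutionGraph (G : Graph) (P : Fin (n G) → Set) (k : ℕ)
                            (D' : RootedTree) (τ' : Fin (n G) → Fin (size D')) : Set where
  field
    height     : HeightAtMost D' k
    injective  : ∀ u v → P u → P v → τ' u ≡ τ' v → u ≡ v
    edges      : ∀ u v → P u → P v → Adj G u v → AncDesc D' (τ' u) (τ' v)
    tree-edges : ∀ u v → P u → P v → TreeEdge D' (τ' u) (τ' v) → Adj G u v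
    leaves     : ∀ x → Leaf D' x → ∃ λ v → P v × (τ' v ≡ x)

-- D = Clos_{D'}(τ'(β(t))) is
-- expressed via an embedding ι : V(D) → V(D') that is injective,
-- preserves root and parent, and has image exactly the closure; so D is
-- (as a rooted tree) the subtree Clos_{D'}(τ'(β t)) of D'.

record PartialSolutionNodeWitness (G : Graph) (T : RootedTree) (β : Bags G T) (k : ℕ)
    (t : Fin (size T)) (D : RootedTree) (τ : Fin (n G) → Fin (size D))
    (S : Subset (size D)) : Set where
  field
    D'        : RootedTree
    τ'        : Fin (n G) → Fin (size D')
    isPS      : PartialSolutionGraph G (InGt G T β t) k D' τ'
    ι         : Fin (size D) → Fin (size D')
    ι-inj     : ∀ x y → ι x ≡ ι y → x ≡ y
    ι-root    : ι (root D) ≡ root D'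
    ι-parent  : ∀ x → x ≢ root D → ι (parent D x) ≡ parent D' (ι x)
    ι-image→  : ∀ y → (∃ λ x → ι x ≡ y) → ∃ λ b → (b ∈ β t) × Anc D' y (τ' b)
    ι-image←  : ∀ y → (∃ λ b → (b ∈ β t) × Anc D' y (τ' b)) → ∃ λ x → ι x ≡ y
    τ-restr   : ∀ b → b ∈ β t → τ' b ≡ ι (τ b)
    S→        : ∀ x → x ∈ S → ∃ λ v → InGt G T β t v × (v ∉ β t) × (τ' v ≡ ι x)
    S←        : ∀ x → (∃ λ v → InGt G T β t v × (v ∉ β t) × (τ' v ≡ ι x)) → x ∈ S
    outside   : ∀ y → ¬ (∃ λ x → ι x ≡ y) →
                ∃ λ v → InGt G T β t v × (v ∉ β t) × (τ' v ≡ y)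

PartialSolutionNode : (G : Graph) (T : RootedTree) (β : Bags G T) (k : ℕ)
    (t : Fin (size T)) (D : RootedTree) (τ : Fin (n G) → Fin (size D))
    (S : Subset (size D)) → Set
PartialSolutionNode G T β k t D τ S =
  (∀ u v → u ∈ β t → v ∈ β t → τ u ≡ τ v → u ≡ v)
  × PartialSolutionNodeWitness G T β k t D τ S

{-# OPTIONS --safe #-}
-- D is the ancestor closure of the at most 2k + 1 vertices τ'(β(t)) in a
-- tree D' of height at most k.  A vertex of the closure is determined by
-- one bag vertex below it together with its depth, since a vertex has at
-- most one ancestor of each depth; hence |V(D)| ≤ (2k + 1) k ≤ 3 k².
-- Only the width and the height bound matter.
module Submission where

open import Defs
open import Data.Nat using (ℕ; _≤_; _<_; _*_; _+_)
open import Data.Nat.Properties using (≤-refl; ≤-reflexive; <⇒≤; <⇒≢; ≤-<-trans; +-comm; *-assoc; +-monoʳ-≤; *-monoˡ-≤; module ≤-Reasoning)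
open import Data.Fin using (Fin; fromℕ<; combine) renaming (zero to fzero; suc to fsuc)
open import Data.Fin.Properties using (injective⇒≤; combine-injective; fromℕ<-injective; suc-injective)
open import Data.Fin.Subset using (Subset; _∈_; ∣_∣; inside; outside)
open import Data.Vec.Base using (_∷_; here; there)
open import Data.Product using (∃; _×_; _,_)
open import Function.Definitions using (Injective)
open import Relation.Nullary using (contradiction)
open import Relation.Binary.PropositionalEquality

memberIndex : ∀ {m} {p : Subset m} {b : Fin m} → b ∈ p → Fin ∣ p ∣
memberIndex here = fzero
memberIndex {p = inside ∷ _} (there b∈p) = fsuc (memberIndex b∈p)
memberIndex {p = outside ∷ _} (there b∈p) = memberIndex b∈p

memberIndex-injective : ∀ {m} {p : Subset m} {b b′ : Fin m} (b∈p : b ∈ p) (b′∈p : b′ ∈ p) →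
                        memberIndex b∈p ≡ memberIndex b′∈p → b ≡ b′
memberIndex-injective here here _ = refl
memberIndex-injective {p = inside ∷ _} (there b∈p) (there b′∈p) eq =
  cong fsuc (memberIndex-injective b∈p b′∈p (suc-injective eq))
memberIndex-injective {p = outside ∷ _} (there b∈p) (there b′∈p) eq =
  cong fsuc (memberIndex-injective b∈p b′∈p eq)

module _ (D : RootedTree) where

  depth-parent-< : ∀ v → v ≢ root D → depth D (parent D v) < depth D v
  depth-parent-< v v≢root = ≤-reflexive (sym (depth-parent D v v≢root))

  Anc⇒depth≤ : ∀ {a b} → Anc D a b → depth D a ≤ depth D b
  Anc⇒depth≤ here = ≤-refl
  Anc⇒depth≤ (step {b} b≢root a≤parent) =
    <⇒≤ (≤-<-trans (Anc⇒depth≤ a≤parent) (depth-parent-< b b≢root))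

  Anc∧depth≡⇒≡ : ∀ {a b} → Anc D a b → depth D a ≡ depth D b → a ≡ b
  Anc∧depth≡⇒≡ here _ = refl
  Anc∧depth≡⇒≡ (step {b} b≢root a≤parent) eq =
    contradiction eq (<⇒≢ (≤-<-trans (Anc⇒depth≤ a≤parent) (depth-parent-< b b≢root)))

  Anc-unique-at-depth : ∀ {a a′ c} → Anc D a c → Anc D a′ c → depth D a ≡ depth D a′ → a ≡ a′
  Anc-unique-at-depth here a′≤a eq = sym (Anc∧depth≡⇒≡ a′≤a (sym eq))
  Anc-unique-at-depth a≤c@(step _ _) here eq = Anc∧depth≡⇒≡ a≤c eq
  Anc-unique-at-depth (step _ a≤c) (step _ a′≤c) eq = Anc-unique-at-depth a≤c a′≤c eq

  ancestorClosure-size≤ : ∀ {k M N} → HeightAtMost D k →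
    (p : Subset M) (τ : Fin M → Fin (size D)) (ι : Fin N → Fin (size D)) → Injective _≡_ _≡_ ι →
    (∀ x → ∃ λ b → b ∈ p × Anc D (ι x) (τ b)) → N ≤ ∣ p ∣ * k
  ancestorClosure-size≤ height p τ ι ι-injective below = injective⇒≤ code-injective
    where
    code : Fin _ → Fin (∣ p ∣ * _)
    code x with below x
    ... | _ , b∈p , _ = combine (memberIndex b∈p) (fromℕ< (height (ι x)))

    code-injective : Injective _≡_ _≡_ code
    code-injective {x} {y} eq with below x | below y
    ... | b , b∈p , ιx≤τb | b′ , b′∈p , ιy≤τb′ with combine-injective _ _ _ _ eq
    ... | same-index , same-depth with refl ← memberIndex-injective b∈p b′∈p same-index =
      ι-injective (Anc-unique-at-depth ιx≤τb ιy≤τb′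
        (fromℕ<-injective _ _ (height (ι x)) (height (ι y)) same-depth))

[2k+1]*k≤3*[k*k] : ∀ {k} → 1 ≤ k → (2 * k + 1) * k ≤ 3 * (k * k)
[2k+1]*k≤3*[k*k] {k} 1≤k = begin
  (2 * k + 1) * k ≤⟨ *-monoˡ-≤ k (+-monoʳ-≤ (2 * k) 1≤k) ⟩
  (2 * k + k) * k ≡⟨ cong (_* k) (+-comm (2 * k) k) ⟩
  3 * k * k       ≡⟨ *-assoc 3 k k ⟩
  3 * (k * k)     ∎
  where open ≤-Reasoning

mainTheorem11 : ∃ λ (c : ℕ) →
    (G : Graph) (k : ℕ) → 1 ≤ k →
    (T : RootedTree) (β : Bags G T) →
    IsNiceTreeDecomposition G T β → WidthAtMost G T β (2 * k) →
    (t : Fin (size T)) (D : RootedTree) (τ : Fin (n G) → Fin (size D)) (S : Subset (size D)) →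
    PartialSolutionNode G T β k t D τ S →
    size D ≤ c * (k * k)
mainTheorem11 = 3 , size≤3k²
  where
  size≤3k² : ∀ G k → 1 ≤ k → ∀ T β → IsNiceTreeDecomposition G T β → WidthAtMost G T β (2 * k) →
             ∀ t D τ S → PartialSolutionNode G T β k t D τ S → size D ≤ 3 * (k * k)
  size≤3k² G k 1≤k T β _ width t D τ S (_ , witness) = begin
    size D          ≤⟨ ancestorClosure-size≤ D′ height (β t) τ′ ι (ι-inj _ _) (λ x → ι-image→ (ι x) (x , refl)) ⟩
    ∣ β t ∣ * k     ≤⟨ *-monoˡ-≤ k (width t) ⟩
    (2 * k + 1) * k ≤⟨ [2k+1]*k≤3*[k*k] 1≤k ⟩
    3 * (k * k)     ∎
    where
    open PartialSolutionNodeWitness witness renaming (D' to D′; τ' to τ′)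
    open PartialSolutionGraph isPS using (height)
    open ≤-Reasoning
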